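{- Let $G=(V,E)$ be a finite simple graph with $d=|V|$ vertices. For each acyclic orientation $\rho$ of $G$ fix a natural labeling of $\Pi_\rho$. Then for every positive integer $n$, \[ \chi^{\mathbf 1}_G(q,n) \;=\; \sum_{\rho\in \mathcal{A}(G)} \ \sum_{\sigma\in \mathcal{L}(\Pi_\rho)}q^{\binom{d+1}{2}-\operatorname{comaj}{\sigma}}\left[ n+\operatorname{des}{\sigma} \atop d \right]_q . \]
   Context: $\chi^{\mathbf 1}_G(q,n):=\sum_c q^{\sum_{v\in V}c(v)}$ over proper colorings $c:V\to\{1,\dots,n\}$ ($c(v)\ne c(w)$ whenever $vw\in E$). $\mathcal{A}(G)$ is the set of acyclic orientations of $G$; $\Pi_\rho$ is the poset on $V$ with $u\preceq w$ iff there is a directed path (possibly of length 0) from $u$ to $w$ in $\rho$. A natural labeling of a poset $\Pi$ on $d$ elements is a bijection $\omega:\Pi\to[d]$ with $\omega(x)<\omega(y)$ whenever $x\prec y$. A linear extension of $\Pi$ is a listing $y_1,\dots,y_d$ of its elements such that $y_i\prec y_j$ implies $i<j$; it is identified with the permutation $\sigma=(\omega(y_1),\dots,\omega(y_d))$ of $[d]$, and $\mathcal{L}(\Pi)$ is the set of these permutations. For a permutation $\sigma$ of $[d]$: $\operatorname{Des}(\sigma)=\{j\in[d-1]:\sigma(j+1)<\sigma(j)\}$, $\operatorname{des}(\sigma)=|\operatorname{Des}(\sigma)|$, $\operatorname{comaj}(\sigma)=\sum_{j\in\operatorname{Des}(\sigma)}(d-j)$. With $[k]_q=1+q+\cdots+q^{k-1}$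 and $[k]_q!=[1]_q\cdots[k]_q$, the $q$-binomial coefficient is $\left[{m\atop d}\right]_q=\frac{[m]_q!}{[d]_q![m-d]_q!}$ for $m\ge d$ and $0$ for $0\le m<d$. -}

module Defs where

open import Data.Bool using (Bool; true; false; _∧_; _∨_; not; if_then_else_)
open import Data.Nat using (ℕ; zero; suc; _+_; _*_; _∸_; _^_; _≤ᵇ_; _<ᵇ_; NonZero)
open import Data.Nat.Properties using (m*n≢0)
open import Data.Nat.DivMod using (_/_)
open import Data.Fin using (Fin; toℕ; _<_; _≟_)
open import Data.Fin.Properties using () renaming (_≟_ to _≟ᶠ_)
open import Data.List using (upTo; List; []; _∷_; _++_; map; concatMap; length; foldr; allFin)
open import Data.Vec using (Vec; lookup; toList)
import Data.Vec as V
open import Data.Empty using (⊥)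
open import Data.Sum using (_⊎_)
open import Data.Product using (_×_; ∃-syntax)
open import Relation.Nullary using (¬_; Dec; does)
open import Relation.Binary.PropositionalEquality using (_≡_; _≢_)

sumL : List ℕ → ℕ
sumL = foldr _+_ 0

allVec : {A : Set} → List A → (d : ℕ) → List (Vec A d)
allVec xs zero    = V.[] ∷ []
allVec xs (suc d) = concatMap (λ x → map (x V.∷_) (allVec xs d)) xs

sumIf : {A : Set} → List A → (A → Bool) → (A → ℕ) → ℕ
sumIf xs p f = sumL (map (λ x → if p x then f x else 0) xs)

andL : List Bool → Bool
andL = foldr _∧_ true

record SimpleGraph (d : ℕ) : Set where
  field
    adj     : Fin d → Fin d → Bool
    symm    : ∀ u v → adj u v ≡ adj v u
    irrefl  : ∀ v → adj v v ≡ false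
open SimpleGraph public

-- q-chromatic function  χ^1_G(q,n), evaluated at q ∈ ℕ.
-- A coloring c : V → {1,…,n} is a vector c of Fin n; the color of v is toℕ (c v) + 1.

colorOf : ∀ {d n} → Vec (Fin n) d → Fin d → ℕ
colorOf c v = suc (toℕ (lookup c v))

properᵇ : ∀ {d n} → SimpleGraph d → Vec (Fin n) d → Bool
properᵇ {d} G c =
  andL (concatMap (λ v → map (λ w →
          not (adj G v w) ∨ not (does (lookup c v ≟ᶠ lookup c w)))
        (allFin d)) (allFin d))

chi1 : ∀ {d} → SimpleGraph d → (q n : ℕ) → ℕ
chi1 {d} G q n =
  sumIf (allVec (allFin n) d) (properᵇ G)
        (λ c → q ^ sumL (map (colorOf c) (allFin d)))

-- Orientations: a Boolean d×d matrix o, with arc u→v iff arc o u v ≡ true.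

Orient : ℕ → Set
Orient d = Vec (Vec Bool d) d

allOrient : (d : ℕ) → List (Orient d)
allOrient d = allVec (allVec (true ∷ false ∷ []) d) d

arc : ∀ {d} → Orient d → Fin d → Fin d → Bool
arc o u v = lookup (lookup o u) v

IsOrientation : ∀ {d} → SimpleGraph d → Orient d → Set
IsOrientation G o =
    (∀ u v → arc o u v ≡ true → adj G u v ≡ true)
  × (∀ u v → adj G u v ≡ true → (arc o u v ≡ true ⊎ arc o v u ≡ true))
  × (∀ u v → arc o u v ≡ true → arc o v u ≡ false)

data Path {d : ℕ} (o : Orient d) : Fin d → Fin d → Set where
  here : ∀ {u} → Path o u u
  step : ∀ {u v w} → arc o u v ≡ true → Path o v w → Path o u w

-- the order of Π_ρ :  u ⪯ w  iff there is a directed path from u to w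
_⪯[_]_ : ∀ {d} → Fin d → Orient d → Fin d → Set
u ⪯[ o ] w = Path o u w

_≺[_]_ : ∀ {d} → Fin d → Orient d → Fin d → Set
u ≺[ o ] w = (u ⪯[ o ] w) × (u ≢ w)

IsAcyclic : ∀ {d} → Orient d → Set
IsAcyclic o = ∀ u v → arc o u v ≡ true → ¬ Path o v u

IsAcyclicOrientation : ∀ {d} → SimpleGraph d → Orient d → Set
IsAcyclicOrientation G o = IsOrientation G o × IsAcyclic o

Bijective : ∀ {d} → (Fin d → Fin d) → Set
Bijective f = (∀ x y → f x ≡ f y → x ≡ y) × (∀ y → ∃[ x ] f x ≡ y)

-- ω : Π_ρ → [d]  (the label ω(x) ∈ [d] is toℕ (ω x) + 1)
IsNaturalLabeling : ∀ {d} → Orient d → (Fin d → Fin d) → Set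
IsNaturalLabeling o ω = Bijective ω × (∀ x y → x ≺[ o ] y → ω x < ω y)

-- a listing y_1,…,y_d (vector y, with y_{i+1} = lookup y i) of the elements of Π_ρ,
-- each element exactly once, with  y_i ≺ y_j ⇒ i < j
IsLinearExtension : ∀ {d} → Orient d → Vec (Fin d) d → Set
IsLinearExtension o y =
  Bijective (lookup y) × (∀ i j → lookup y i ≺[ o ] lookup y j → i < j)

allListings : (d : ℕ) → List (Vec (Fin d) d)
allListings d = allVec (allFin d) d

des : List ℕ → ℕ
des []          = 0
des (x ∷ [])    = 0
des (x ∷ y ∷ r) = (if y <ᵇ x then 1 else 0) + des (y ∷ r)

-- comaj = Σ_{j ∈ Des} (d − j); a descent at position j of a word of length d
-- contributes d − j = the number of letters after position j
comaj : List ℕ → ℕ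
comaj []          = 0
comaj (x ∷ [])    = 0
comaj (x ∷ y ∷ r) = (if y <ᵇ x then length (y ∷ r) else 0) + comaj (y ∷ r)

-- the permutation σ = (ω(y_1), …, ω(y_d)) as a word
word : ∀ {d} → (Fin d → Fin d) → Vec (Fin d) d → List ℕ
word {d} ω y = map (λ i → suc (toℕ (ω (lookup y i)))) (allFin d)

qint : ℕ → ℕ → ℕ
qint q k = sumL (map (q ^_) (upTo k))

qfact : ℕ → ℕ → ℕ
qfact q zero    = 1
qfact q (suc k) = qint q (suc k) * qfact q k

qint-nz : ∀ q k → NonZero (qint q (suc k))
qint-nz q k = _

qfact-nz : ∀ q k → NonZero (qfact q k)
qfact-nz q zero    = _
qfact-nz q (suc k) = m*n≢0 (qint q (suc k)) (qfact q k) {{qint-nz q k}} {{qfact-nz q k}}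

qbinom : ℕ → ℕ → ℕ → ℕ
qbinom q m k with k ≤ᵇ m
... | true  = _/_ (qfact q m) (qfact q k * qfact q (m ∸ k))
                  {{m*n≢0 (qfact q k) (qfact q (m ∸ k)) {{qfact-nz q k}} {{qfact-nz q (m ∸ k)}}}}
... | false = 0

-- A proper colouring c determines an acyclic orientation ρ (each edge points to its larger
-- colour) and, given the natural labelling ω of Π_ρ, a linear extension σ: the vertices by
-- increasing colour, ties broken by decreasing label. Conversely, for every pair (ρ, σ)
-- the colourings arising from it are exactly those whose colours, read along σ, weakly
-- increase and strictly increase at the ascents of σ. So χ¹_G is the sum over (ρ, σ) of
-- Σ q^(colour sum) over such σ-compatible sequences with values in [n]. Splitting off the
-- first colour and keeping the lower bound for it as a parameter, this sum satisfies the
-- q-Pascal recurrence, which gives q^(binom(d+1,2) - comaj σ) [n + des σ, d]_q.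

module Submission where

open import Defs
open import Data.Bool using (Bool; true; false; T; _∧_; _∨_; not; if_then_else_)
open import Data.Bool.Properties using (T-∧; T-≡; ⇔→≡; T?)
open import Data.Empty using (⊥-elim)
open import Data.Fin as Fin using (Fin; toℕ) renaming (zero to fzero; suc to fsuc)
import Data.Fin.Properties as Fin
open import Data.List as List using (List; []; _∷_; _++_; map; concatMap; allFin; length; upTo; applyUpTo)
import Data.List.Properties as List
import Data.List.Relation.Unary.All as ListAll
import Data.List.Relation.Unary.All.Properties as ListAll
open import Data.Nat using (ℕ; zero; suc; _+_; _*_; _∸_; _^_; _≤_; _<_; _≤ᵇ_; _<ᵇ_; z≤n; s≤s; NonZero)
open import Data.Nat.Properties
open import Algebra.Properties.CommutativeSemigroup +-commutativeSemigroup using (interchange)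
open import Data.Nat.Combinatorics using (_C_; nC1≡n; nCk+nC[k+1]≡[n+1]C[k+1])
open import Data.Nat.DivMod using (_/_; m*n/n≡m)
open import Data.Nat.ListAction.Properties using (sum-++)
open import Data.Nat.Tactic.RingSolver using (solve-∀)
open import Data.Product using (_×_; _,_; proj₁; proj₂; ∃-syntax)
open import Data.Sum using (_⊎_; inj₁; inj₂)
open import Data.Unit using (tt)
open import Data.Vec as Vec using (Vec; lookup; toList)
import Data.Vec.Properties as Vec
open import Data.Vec.Membership.Propositional using (_∈_)
open import Data.Vec.Membership.Propositional.Properties using (∈-lookup; ∈-allFin⁺)
open import Data.Vec.Relation.Unary.All as All using (All; []; _∷_)
import Data.Vec.Relation.Unary.All.Properties as All
open import Data.Vec.Relation.Unary.AllPairs as AllPairs using (AllPairs; []; _∷_)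
import Data.Vec.Relation.Unary.AllPairs.Properties as AllPairs
open import Data.Vec.Relation.Unary.Any as Any using (Any; here; there)
open import Data.Vec.Relation.Unary.Any.Properties using (lookup-index)
open import Function using (_∘_; _⇔_; mk⇔; Equivalence)
open import Level using (0ℓ)
open import Relation.Binary.Core using (Rel)
open import Relation.Binary.Definitions using (DecidableEquality; Decidable; Transitive; tri<; tri≈; tri>)
open import Relation.Binary.PropositionalEquality hiding ([_])
open import Relation.Nullary using (¬_; Dec; yes; no; does)
open import Relation.Nullary.Decidable using (_⊎-dec_; _×-dec_; dec-true)

sumOver : {A : Set} → List A → (A → ℕ) → ℕ
sumOver xs f = sumL (map f xs)

infix 5 sumOver
syntax sumOver xs (λ x → e) = ∑[ x ∈ xs ] e

infixr 5 [_]*_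

[_]*_ : Bool → ℕ → ℕ
[ b ]* x = if b then x else 0

[]*-cong : ∀ b {x y} → (T b → x ≡ y) → [ b ]* x ≡ [ b ]* y
[]*-cong true  x≡y = x≡y tt
[]*-cong false _   = refl

[]*-true : ∀ {b} x → T b → [ b ]* x ≡ x
[]*-true {true} x _ = refl

[]*-false : ∀ {b} x → ¬ T b → [ b ]* x ≡ 0
[]*-false {true}  x ¬tt = ⊥-elim (¬tt tt)
[]*-false {false} x _   = refl

[]*-∧ : ∀ a b x → [ a ]* [ b ]* x ≡ [ a ∧ b ]* x
[]*-∧ true  b x = refl
[]*-∧ false b x = refl

module _ {A : Set} where

  sumOver-cong : (xs : List A) {f g : A → ℕ} → (∀ x → f x ≡ g x) → sumOver xs f ≡ sumOver xs g
  sumOver-cong xs f≗g = cong sumL (List.map-cong f≗g xs)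

  sumOver-++ : (xs ys : List A) (f : A → ℕ) → sumOver (xs ++ ys) f ≡ sumOver xs f + sumOver ys f
  sumOver-++ xs ys f = trans (cong sumL (List.map-++ f xs ys)) (sum-++ (map f xs) (map f ys))

  sumOver-zero : (xs : List A) {f : A → ℕ} → (∀ x → f x ≡ 0) → sumOver xs f ≡ 0
  sumOver-zero []       f≡0 = refl
  sumOver-zero (x ∷ xs) f≡0 = cong₂ _+_ (f≡0 x) (sumOver-zero xs f≡0)

  sumOver-+ : (xs : List A) (f g : A → ℕ) → ∑[ x ∈ xs ] (f x + g x) ≡ sumOver xs f + sumOver xs g
  sumOver-+ []       f g = refl
  sumOver-+ (x ∷ xs) f g = begin
    f x + g x + (∑[ x ∈ xs ] (f x + g x))      ≡⟨ cong (f x + g x +_) (sumOver-+ xs f g) ⟩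
    f x + g x + (sumOver xs f + sumOver xs g)  ≡⟨ interchange (f x) (g x) _ _ ⟩
    f x + sumOver xs f + (g x + sumOver xs g)  ∎
    where open ≡-Reasoning

  sumOver-*ˡ : (xs : List A) (k : ℕ) (f : A → ℕ) → ∑[ x ∈ xs ] (k * f x) ≡ k * sumOver xs f
  sumOver-*ˡ []       k f = sym (*-zeroʳ k)
  sumOver-*ˡ (x ∷ xs) k f =
    trans (cong (k * f x +_) (sumOver-*ˡ xs k f)) (sym (*-distribˡ-+ k (f x) _))

  sumOver-[]* : (xs : List A) (b : Bool) (f : A → ℕ) → [ b ]* sumOver xs f ≡ ∑[ x ∈ xs ] [ b ]* f x
  sumOver-[]* xs true  f = refl
  sumOver-[]* xs false f = sym (sumOver-zero xs (λ _ → refl))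

module _ {A B : Set} where

  sumOver-map : (g : A → B) (xs : List A) (f : B → ℕ) → sumOver (map g xs) f ≡ sumOver xs (f ∘ g)
  sumOver-map g xs f = cong sumL (sym (List.map-∘ xs))

  sumOver-concatMap : (g : A → List B) (xs : List A) (f : B → ℕ) →
                      sumOver (concatMap g xs) f ≡ ∑[ x ∈ xs ] sumOver (g x) f
  sumOver-concatMap g []       f = refl
  sumOver-concatMap g (x ∷ xs) f =
    trans (sumOver-++ (g x) (concatMap g xs) f) (cong (sumOver (g x) f +_) (sumOver-concatMap g xs f))

  sumOver-comm : (xs : List A) (ys : List B) (f : A → B → ℕ) →
                 ∑[ x ∈ xs ] ∑[ y ∈ ys ] f x y ≡ ∑[ y ∈ ys ] ∑[ x ∈ xs ] f x y
  sumOver-comm []       ys f = sym (sumOver-zero ys (λ _ → refl))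
  sumOver-comm (x ∷ xs) ys f =
    trans (cong (sumOver ys (f x) +_) (sumOver-comm xs ys f)) (sym (sumOver-+ ys (f x) _))

  sumOver-[]*-comm : (xs : List A) (ys : List B) (p : A → Bool) (f : A → B → ℕ) →
                     ∑[ x ∈ xs ] [ p x ]* ∑[ y ∈ ys ] f x y ≡ ∑[ y ∈ ys ] ∑[ x ∈ xs ] [ p x ]* f x y
  sumOver-[]*-comm xs ys p f =
    trans (sumOver-cong xs (λ x → sumOver-[]* ys (p x) (f x))) (sumOver-comm xs ys _)

sumOver-suc : {A : Set} (xs : List A) (f : A → ℕ) → ∑[ x ∈ xs ] suc (f x) ≡ length xs + sumOver xs f
sumOver-suc xs f = trans (sumOver-+ xs (λ _ → 1) f) (cong (_+ sumOver xs f) (ones xs))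
  where
  ones : ∀ xs → ∑[ x ∈ xs ] 1 ≡ length xs
  ones []       = refl
  ones (_ ∷ xs) = cong suc (ones xs)

map-allFin-suc : {B : Set} (n : ℕ) (f : Fin (suc n) → B) →
                 map f (allFin (suc n)) ≡ f fzero ∷ map (f ∘ fsuc) (allFin n)
map-allFin-suc n f =
  cong (f fzero ∷_) (trans (List.map-tabulate fsuc f) (sym (List.map-tabulate (λ i → i) (f ∘ fsuc))))

map-allFin-lookup : {A B : Set} {k : ℕ} (f : A → B) (w : Vec A k) →
                    map (λ i → f (lookup w i)) (allFin k) ≡ map f (toList w)
map-allFin-lookup f Vec.[]      = refl
map-allFin-lookup f (x Vec.∷ w) = trans (map-allFin-suc _ _) (cong (f x ∷_) (map-allFin-lookup f w))

sumOver-allFin-suc : ∀ n (f : Fin (suc n) → ℕ) →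
                     sumOver (allFin (suc n)) f ≡ f fzero + sumOver (allFin n) (f ∘ fsuc)
sumOver-allFin-suc n f = cong sumL (map-allFin-suc n f)

sumOver-allVec-suc : {A : Set} (xs : List A) (k : ℕ) (f : Vec A (suc k) → ℕ) →
                     sumOver (allVec xs (suc k)) f ≡ ∑[ x ∈ xs ] ∑[ v ∈ allVec xs k ] f (x Vec.∷ v)
sumOver-allVec-suc xs k f =
  trans (sumOver-concatMap _ xs f) (sumOver-cong xs (λ x → sumOver-map (x Vec.∷_) (allVec xs k) f))

suc≤ᵇsuc : ∀ m n → (suc m ≤ᵇ suc n) ≡ (m ≤ᵇ n)
suc≤ᵇsuc zero    n = refl
suc≤ᵇsuc (suc m) n = refl

sumOver-≥-recurrence : ∀ n (φ C : ℕ → ℕ) →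
                       (∀ lo → n ≤ lo → C lo ≡ 0) → (∀ lo → lo < n → C lo ≡ φ lo + C (suc lo)) →
                       ∀ lo → ∑[ x ∈ allFin n ] [ lo ≤ᵇ toℕ x ]* φ (toℕ x) ≡ C lo
sumOver-≥-recurrence zero    φ C C-vanishes C-step lo = sym (C-vanishes lo z≤n)
sumOver-≥-recurrence (suc n) φ C C-vanishes C-step lo =
  trans (sumOver-allFin-suc n _) (first-term lo)
  where
  rest : ∀ lo → ∑[ x ∈ allFin n ] [ lo ≤ᵇ toℕ x ]* φ (suc (toℕ x)) ≡ C (suc lo)
  rest = sumOver-≥-recurrence n (φ ∘ suc) (C ∘ suc) (λ lo n≤lo → C-vanishes (suc lo) (s≤s n≤lo))
                                (λ lo lo<n → C-step (suc lo) (s≤s lo<n))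
  first-term : ∀ lo →
               ([ lo ≤ᵇ 0 ]* φ 0) + (∑[ x ∈ allFin n ] [ lo ≤ᵇ suc (toℕ x) ]* φ (suc (toℕ x))) ≡ C lo
  first-term zero     = trans (cong (φ 0 +_) (rest 0)) (sym (C-step 0 (s≤s z≤n)))
  first-term (suc lo) =
    trans (sumOver-cong (allFin n) (λ x → cong (λ b → [ b ]* φ (suc (toℕ x))) (suc≤ᵇsuc lo (toℕ x)))) (rest lo)

-- xs lists every element exactly once; only this consequence for sums is ever needed.
IsEnumeration : {A : Set} → List A → Set
IsEnumeration {A} xs = ∀ (f : A → ℕ) x₀ → (∀ x → x ≢ x₀ → f x ≡ 0) → sumOver xs f ≡ f x₀

allFin-isEnumeration : ∀ n → IsEnumeration (allFin n)
allFin-isEnumeration (suc n) f fzero f≡0 = begin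
  sumOver (allFin (suc n)) f              ≡⟨ sumOver-allFin-suc n f ⟩
  f fzero + sumOver (allFin n) (f ∘ fsuc) ≡⟨ cong (f fzero +_) (sumOver-zero (allFin n) (λ x → f≡0 (fsuc x) λ ())) ⟩
  f fzero + 0                             ≡⟨ +-identityʳ _ ⟩
  f fzero                                 ∎
  where open ≡-Reasoning
allFin-isEnumeration (suc n) f (fsuc x₀) f≡0 = begin
  sumOver (allFin (suc n)) f              ≡⟨ sumOver-allFin-suc n f ⟩
  f fzero + sumOver (allFin n) (f ∘ fsuc) ≡⟨ cong₂ _+_ (f≡0 fzero λ ()) (allFin-isEnumeration n (f ∘ fsuc) x₀ others) ⟩
  f (fsuc x₀)                             ∎
  where
  open ≡-Reasoning
  others : ∀ x → x ≢ x₀ → f (fsuc x) ≡ 0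
  others x x≢x₀ = f≡0 (fsuc x) (x≢x₀ ∘ Fin.suc-injective)

bools-isEnumeration : IsEnumeration (true ∷ false ∷ [])
bools-isEnumeration f true  f≡0 = trans (cong (f true +_) (cong (_+ 0) (f≡0 false λ ()))) (+-identityʳ _)
bools-isEnumeration f false f≡0 = trans (cong (_+ (f false + 0)) (f≡0 true λ ())) (+-identityʳ _)

allVec-isEnumeration : {A : Set} {xs : List A} → IsEnumeration xs → ∀ k → IsEnumeration (allVec xs k)
allVec-isEnumeration xs-enum zero f Vec.[] f≡0 = +-identityʳ (f Vec.[])
allVec-isEnumeration {xs = xs} xs-enum (suc k) f (a Vec.∷ v₀) f≡0 = begin
  sumOver (allVec xs (suc k)) f                         ≡⟨ sumOver-allVec-suc xs k f ⟩
  ∑[ x ∈ xs ] ∑[ v ∈ allVec xs k ] f (x Vec.∷ v)         ≡⟨ xs-enum _ a other-heads ⟩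
  ∑[ v ∈ allVec xs k ] f (a Vec.∷ v)                     ≡⟨ allVec-isEnumeration xs-enum k _ v₀ other-tails ⟩
  f (a Vec.∷ v₀)                                         ∎
  where
  open ≡-Reasoning
  other-heads : ∀ x → x ≢ a → ∑[ v ∈ allVec xs k ] f (x Vec.∷ v) ≡ 0
  other-heads x x≢a = sumOver-zero (allVec xs k) (λ v → f≡0 _ (x≢a ∘ proj₁ ∘ Vec.∷-injective))
  other-tails : ∀ v → v ≢ v₀ → f (a Vec.∷ v) ≡ 0
  other-tails v v≢v₀ = f≡0 _ (v≢v₀ ∘ proj₂ ∘ Vec.∷-injective)

module _ {A B : Set} (xs : List A) (ys : List B) (xs-enum : IsEnumeration xs) (ys-enum : IsEnumeration ys)
         (p : A → B → Bool) (w : ℕ) where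

  sumOver²-unique : ∀ x₀ y₀ → T (p x₀ y₀) → (∀ x y → T (p x y) → x ≡ x₀ × y ≡ y₀) →
                    ∑[ x ∈ xs ] ∑[ y ∈ ys ] [ p x y ]* w ≡ w
  sumOver²-unique x₀ y₀ p₀ unique = begin
    ∑[ x ∈ xs ] ∑[ y ∈ ys ] [ p x y ]* w
      ≡⟨ xs-enum _ x₀ (λ x x≢x₀ → sumOver-zero ys (λ y → []*-false w (x≢x₀ ∘ proj₁ ∘ unique x y))) ⟩
    ∑[ y ∈ ys ] [ p x₀ y ]* w
      ≡⟨ ys-enum _ y₀ (λ y y≢y₀ → []*-false w (y≢y₀ ∘ proj₂ ∘ unique x₀ y)) ⟩
    [ p x₀ y₀ ]* w                      ≡⟨ []*-true w p₀ ⟩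
    w                                   ∎
    where open ≡-Reasoning

sumOver-reindex : {A B : Set} (xs : List A) (ys : List B) → IsEnumeration xs → IsEnumeration ys →
                  DecidableEquality B → (g : A → B) (h : B → A) →
                  (∀ x → h (g x) ≡ x) → (∀ y → g (h y) ≡ y) →
                  (f : A → ℕ) → sumOver xs f ≡ sumOver ys (f ∘ h)
sumOver-reindex {A} {B} xs ys xs-enum ys-enum _≟_ g h hg≡id gh≡id f = begin
  sumOver xs f
    ≡⟨ sumOver-cong xs (λ x → sym (trans (ys-enum _ (g x) (graph-off x)) (graph-on x (g x) refl))) ⟩
  ∑[ x ∈ xs ] ∑[ y ∈ ys ] graph x y
    ≡⟨ sumOver-comm xs ys graph ⟩
  ∑[ y ∈ ys ] ∑[ x ∈ xs ] graph x y
    ≡⟨ sumOver-cong ys (λ y → xs-enum _ (h y) (λ x x≢hy → graph-off x y (x≢hy ∘ inverse x y))) ⟩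
  ∑[ y ∈ ys ] graph (h y) y
    ≡⟨ sumOver-cong ys (λ y → graph-on (h y) y (sym (gh≡id y))) ⟩
  sumOver ys (f ∘ h)
    ∎
  where
  open ≡-Reasoning
  graph : A → B → ℕ
  graph x y = [ does (y ≟ g x) ]* f x
  graph-on : ∀ x y → y ≡ g x → graph x y ≡ f x
  graph-on x y y≡gx with y ≟ g x
  ... | yes _   = refl
  ... | no y≢gx = ⊥-elim (y≢gx y≡gx)
  graph-off : ∀ x y → y ≢ g x → graph x y ≡ 0
  graph-off x y y≢gx with y ≟ g x
  ... | yes y≡gx = ⊥-elim (y≢gx y≡gx)
  ... | no _     = refl
  inverse : ∀ x y → y ≡ g x → x ≡ h y
  inverse x y y≡gx = trans (sym (hg≡id x)) (cong h (sym y≡gx))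

qint-suc : ∀ q k → qint q (suc k) ≡ 1 + q * qint q k
qint-suc q k = cong (1 +_) (begin
  sumL (map (q ^_) (applyUpTo suc k))  ≡⟨ cong sumL (List.map-applyUpTo suc (q ^_) k) ⟩
  sumL (applyUpTo (λ i → q * q ^ i) k) ≡⟨ cong sumL (sym (List.map-applyUpTo (λ i → i) _ k)) ⟩
  ∑[ i ∈ upTo k ] q * q ^ i            ≡⟨ sumOver-*ˡ (upTo k) q (q ^_) ⟩
  q * qint q k                         ∎)
  where open ≡-Reasoning

qint-+ : ∀ q a b → qint q (a + b) ≡ qint q a + q ^ a * qint q b
qint-+ q zero    b = sym (+-identityʳ (qint q b))
qint-+ q (suc a) b = begin
  qint q (suc (a + b))                                  ≡⟨ qint-suc q (a + b) ⟩
  1 + q * qint q (a + b)                                ≡⟨ cong (λ x → 1 + q * x) (qint-+ q a b) ⟩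
  1 + q * (qint q a + q ^ a * qint q b)                 ≡⟨ distrib q (qint q a) (q ^ a) (qint q b) ⟩
  (1 + q * qint q a) + q * q ^ a * qint q b             ≡⟨ cong (_+ q * q ^ a * qint q b) (sym (qint-suc q a)) ⟩
  qint q (suc a) + q ^ suc a * qint q b                 ∎
  where
  open ≡-Reasoning
  distrib : ∀ q x y z → 1 + q * (x + y * z) ≡ (1 + q * x) + q * y * z
  distrib = solve-∀

gaussian : ℕ → ℕ → ℕ → ℕ
gaussian q m       zero    = 1
gaussian q zero    (suc k) = 0
gaussian q (suc m) (suc k) = gaussian q m k + q ^ suc k * gaussian q m (suc k)

gaussian-< : ∀ q {m k} → m < k → gaussian q m k ≡ 0
gaussian-< q {zero}  {suc k} _         = refl
gaussian-< q {suc m} {suc k} (s≤s m<k)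
  rewrite gaussian-< q m<k | gaussian-< q (m<n⇒m<1+n m<k) = *-zeroʳ (q ^ suc k)

gaussian-diag : ∀ q m → gaussian q m m ≡ 1
gaussian-diag q zero    = refl
gaussian-diag q (suc m)
  rewrite gaussian-diag q m | gaussian-< q (n<1+n m) = cong suc (*-zeroʳ (q ^ suc m))

gaussian-qfact : ∀ q k j → gaussian q (k + j) k * (qfact q k * qfact q j) ≡ qfact q (k + j)
gaussian-qfact q zero    j = trans (+-identityʳ _) (+-identityʳ _)
gaussian-qfact q (suc k) zero
  rewrite +-identityʳ k | gaussian-diag q (suc k) = trans (+-identityʳ _) (*-identityʳ _)
gaussian-qfact q (suc k) (suc j) = begin
  (g₁ + q ^ suc k * g₂) * ((Qk * fk) * (Qj * fj))
    ≡⟨ regroup g₁ (q ^ suc k) g₂ Qk fk Qj fj ⟩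
  g₁ * (fk * (Qj * fj)) * Qk + q ^ suc k * (g₂ * ((Qk * fk) * fj)) * Qj
    ≡⟨ cong₂ (λ a b → a * Qk + q ^ suc k * b * Qj) (gaussian-qfact q k (suc j)) shifted ⟩
  F * Qk + q ^ suc k * F * Qj
    ≡⟨ factor F Qk (q ^ suc k) Qj ⟩
  (Qk + q ^ suc k * Qj) * F
    ≡⟨ cong (_* F) (sym (qint-+ q (suc k) (suc j))) ⟩
  qint q (suc (k + suc j)) * F
    ∎
  where
  open ≡-Reasoning
  g₁ = gaussian q (k + suc j) k
  g₂ = gaussian q (k + suc j) (suc k)
  Qk = qint q (suc k)
  Qj = qint q (suc j)
  fk = qfact q k
  fj = qfact q j
  F  = qfact q (k + suc j)
  shifted : g₂ * (qfact q (suc k) * fj) ≡ F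
  shifted = subst (λ m → gaussian q m (suc k) * (qfact q (suc k) * fj) ≡ qfact q m)
                  (sym (+-suc k j)) (gaussian-qfact q (suc k) j)
  regroup : ∀ a b c d e f g →
            (a + b * c) * ((d * e) * (f * g)) ≡ a * (e * (f * g)) * d + b * (c * ((d * e) * g)) * f
  regroup = solve-∀
  factor : ∀ a b c d → a * b + c * a * d ≡ (b + c * d) * a
  factor = solve-∀

qbinom≡gaussian : ∀ q m k → qbinom q m k ≡ gaussian q m k
qbinom≡gaussian q m k with k ≤ᵇ m in k≤ᵇm
... | false = sym (gaussian-< q {m} {k} (≰⇒> (λ k≤m → subst T k≤ᵇm (≤⇒≤ᵇ k≤m))))
... | true  = begin
  qfact q m / (qfact q k * qfact q (m ∸ k))
    ≡⟨ cong (_/ (qfact q k * qfact q (m ∸ k))) (sym product) ⟩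
  gaussian q m k * (qfact q k * qfact q (m ∸ k)) / (qfact q k * qfact q (m ∸ k))
    ≡⟨ m*n/n≡m (gaussian q m k) _ ⟩
  gaussian q m k ∎
  where
  open ≡-Reasoning
  instance
    denominator≢0 : NonZero (qfact q k * qfact q (m ∸ k))
    denominator≢0 = m*n≢0 (qfact q k) (qfact q (m ∸ k)) {{qfact-nz q k}} {{qfact-nz q (m ∸ k)}}
  product : gaussian q m k * (qfact q k * qfact q (m ∸ k)) ≡ qfact q m
  product = subst (λ m′ → gaussian q m′ k * (qfact q k * qfact q (m ∸ k)) ≡ qfact q m′)
                  (m+[n∸m]≡n (≤ᵇ⇒≤ k m (subst T (sym k≤ᵇm) tt))) (gaussian-qfact q k (m ∸ k))

m<n⇒n∸m≡1+[n∸1+m] : ∀ {m n} → m < n → n ∸ m ≡ suc (n ∸ suc m)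
m<n⇒n∸m≡1+[n∸1+m] m<n = +-∸-assoc 1 m<n

^-*-merge : ∀ q a b x → q ^ a * (q ^ b * x) ≡ q ^ (a + b) * x
^-*-merge q a b x = trans (sym (*-assoc (q ^ a) (q ^ b) x)) (cong (_* x) (sym (^-distribˡ-+-* q a b)))

gaussian-step : ∀ q e {n lo} D k → lo < n →
                q ^ e * gaussian q (n ∸ lo + D) (suc k)
                ≡ q ^ e * gaussian q (n ∸ suc lo + D) k + q ^ (e + suc k) * gaussian q (n ∸ suc lo + D) (suc k)
gaussian-step q e {n} {lo} D k lo<n = begin
  q ^ e * gaussian q (n ∸ lo + D) (suc k)
    ≡⟨ cong (λ m → q ^ e * gaussian q (m + D) (suc k)) (m<n⇒n∸m≡1+[n∸1+m] lo<n) ⟩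
  q ^ e * (gaussian q m k + q ^ suc k * gaussian q m (suc k))
    ≡⟨ *-distribˡ-+ (q ^ e) _ _ ⟩
  q ^ e * gaussian q m k + q ^ e * (q ^ suc k * gaussian q m (suc k))
    ≡⟨ cong (q ^ e * gaussian q m k +_) (^-*-merge q e (suc k) _) ⟩
  q ^ e * gaussian q m k + q ^ (e + suc k) * gaussian q m (suc k)
    ∎
  where
  open ≡-Reasoning
  m = n ∸ suc lo + D

startsWithDescent : ℕ → List ℕ → Bool
startsWithDescent s []       = false
startsWithDescent s (s′ ∷ _) = s′ <ᵇ s

gapAfter : ℕ → List ℕ → ℕ
gapAfter s σ = if startsWithDescent s σ then 0 else 1

-- The colour sequence a (as long as σ) starts at lo or above and never decreases;
-- consecutive colours may be equal only across a descent of σ.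
compatibleFrom : ℕ → List ℕ → List ℕ → Bool
compatibleFrom lo []      _       = true
compatibleFrom lo (s ∷ σ) []      = false
compatibleFrom lo (s ∷ σ) (x ∷ a) = (lo ≤ᵇ x) ∧ compatibleFrom (x + gapAfter s σ) σ a

ascentComaj : List ℕ → ℕ
ascentComaj []      = 0
ascentComaj (s ∷ σ) = (if startsWithDescent s σ then 0 else length σ) + ascentComaj σ

des-∷ : ∀ s σ → des (s ∷ σ) ≡ (if startsWithDescent s σ then 1 else 0) + des σ
des-∷ s []      = refl
des-∷ s (_ ∷ _) = refl

comaj-∷ : ∀ s σ → comaj (s ∷ σ) ≡ (if startsWithDescent s σ then length σ else 0) + comaj σ
comaj-∷ s []      = refl
comaj-∷ s (_ ∷ _) = refl

des-∷-≤ : ∀ s σ → des (s ∷ σ) ≤ length σ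
des-∷-≤ s []       = z≤n
des-∷-≤ s (s′ ∷ σ) with s′ <ᵇ s
... | true  = s≤s (des-∷-≤ s′ σ)
... | false = m≤n⇒m≤1+n (des-∷-≤ s′ σ)

suc-C-2 : ∀ k → suc k C 2 ≡ k + k C 2
suc-C-2 k = trans (sym (nCk+nC[k+1]≡[n+1]C[k+1] k 1)) (cong (_+ k C 2) (nC1≡n k))

ascentComaj+comaj : ∀ σ → ascentComaj σ + comaj σ ≡ length σ C 2
ascentComaj+comaj []      = refl
ascentComaj+comaj (s ∷ σ) = begin
  ascentComaj (s ∷ σ) + comaj (s ∷ σ)           ≡⟨ cong (ascentComaj (s ∷ σ) +_) (comaj-∷ s σ) ⟩
  (a + ascentComaj σ) + (c + comaj σ)           ≡⟨ interchange a (ascentComaj σ) c (comaj σ) ⟩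
  (a + c) + (ascentComaj σ + comaj σ)           ≡⟨ cong₂ _+_ (split (startsWithDescent s σ)) (ascentComaj+comaj σ) ⟩
  length σ + length σ C 2                       ≡⟨ sym (suc-C-2 (length σ)) ⟩
  suc (length σ) C 2                            ∎
  where
  open ≡-Reasoning
  a = if startsWithDescent s σ then 0 else length σ
  c = if startsWithDescent s σ then length σ else 0
  split : ∀ b → (if b then 0 else length σ) + (if b then length σ else 0) ≡ length σ
  split true  = refl
  split false = +-identityʳ (length σ)

-- The closed form of compatibleSum for a word s ∷ σ, as a function of the lower bound lo,
-- obeys the recurrence of sumOver-≥-recurrence; b says whether s ∷ σ starts with a descent.
closedForm-∷-recurrence : ∀ q n b k A D lo → lo < n →
  q ^ (lo * suc k + ((if b then 0 else k) + A)) * gaussian q (n ∸ lo + ((if b then 1 else 0) + D)) (suc k)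
  ≡ q ^ lo * (q ^ ((lo + (if b then 0 else 1)) * k + A) * gaussian q (n ∸ (lo + (if b then 0 else 1)) + D) k)
    + q ^ (suc lo * suc k + ((if b then 0 else k) + A)) * gaussian q (n ∸ suc lo + ((if b then 1 else 0) + D)) (suc k)
closedForm-∷-recurrence q n b k A D lo lo<n =
  trans (gaussian-step q e D′ k lo<n) (cong₂ _+_ first second)
  where
  A′ = (if b then 0 else k) + A
  D′ = (if b then 1 else 0) + D
  g  = if b then 0 else 1
  e  = lo * suc k + A′
  exponent : ∀ b → lo + ((lo + (if b then 0 else 1)) * k + A) ≡ lo * suc k + ((if b then 0 else k) + A)
  exponent true  = descent lo k A
    where descent : ∀ lo k A → lo + ((lo + 0) * k + A) ≡ lo * suc k + (0 + A)
          descent = solve-∀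
  exponent false = ascent lo k A
    where ascent : ∀ lo k A → lo + ((lo + 1) * k + A) ≡ lo * suc k + (k + A)
          ascent = solve-∀
  argument : ∀ b → n ∸ (lo + (if b then 0 else 1)) + D ≡ n ∸ suc lo + ((if b then 1 else 0) + D)
  argument true  = begin
    n ∸ (lo + 0) + D     ≡⟨ cong (λ l → n ∸ l + D) (+-identityʳ lo) ⟩
    n ∸ lo + D           ≡⟨ cong (_+ D) (m<n⇒n∸m≡1+[n∸1+m] lo<n) ⟩
    suc (n ∸ suc lo) + D ≡⟨ sym (+-suc (n ∸ suc lo) D) ⟩
    n ∸ suc lo + suc D   ∎
    where open ≡-Reasoning
  argument false = cong (λ l → n ∸ l + D) (+-comm lo 1)
  shift : ∀ x X k → x + X + suc k ≡ suc k + x + X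
  shift = solve-∀
  first : q ^ e * gaussian q (n ∸ suc lo + D′) k
          ≡ q ^ lo * (q ^ ((lo + g) * k + A) * gaussian q (n ∸ (lo + g) + D) k)
  first = sym (trans (^-*-merge q lo _ _) (cong₂ (λ e′ m → q ^ e′ * gaussian q m k) (exponent b) (argument b)))
  second : q ^ (e + suc k) * gaussian q (n ∸ suc lo + D′) (suc k)
           ≡ q ^ (suc lo * suc k + A′) * gaussian q (n ∸ suc lo + D′) (suc k)
  second = cong (λ e′ → q ^ e′ * gaussian q (n ∸ suc lo + D′) (suc k)) (shift (lo * suc k) A′ k)

values : ∀ {n k} → Vec (Fin n) k → List ℕ
values a = map toℕ (toList a)

compatibleSum : (n q : ℕ) → List ℕ → ℕ → ℕ
compatibleSum n q σ lo =
  ∑[ a ∈ allVec (allFin n) (length σ) ] [ compatibleFrom lo σ (values a) ]* q ^ sumL (values a)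

sumOver-[∧]*-^ : {A : Set} (xs : List A) (b : Bool) (p : A → Bool) (q t : ℕ) (w : A → ℕ) →
                 ∑[ x ∈ xs ] [ b ∧ p x ]* q ^ (t + w x) ≡ [ b ]* q ^ t * (∑[ x ∈ xs ] [ p x ]* q ^ w x)
sumOver-[∧]*-^ xs false p q t w = sumOver-zero xs (λ _ → refl)
sumOver-[∧]*-^ xs true  p q t w =
  trans (sumOver-cong xs (λ x → factor (p x) (w x))) (sumOver-*ˡ xs (q ^ t) (λ x → [ p x ]* q ^ w x))
  where
  factor : ∀ b w → [ b ]* q ^ (t + w) ≡ q ^ t * ([ b ]* q ^ w)
  factor true  w = ^-distribˡ-+-* q t w
  factor false w = sym (*-zeroʳ (q ^ t))

compatibleSum-closedForm : ∀ n q σ lo →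
  compatibleSum n q σ lo ≡ q ^ (lo * length σ + ascentComaj σ) * gaussian q (n ∸ lo + des σ) (length σ)
compatibleSum-closedForm n q []      lo rewrite *-zeroʳ lo = refl
compatibleSum-closedForm n q (s ∷ σ) lo = begin
  compatibleSum n q (s ∷ σ) lo
    ≡⟨ sumOver-allVec-suc (allFin n) (length σ) _ ⟩
  ∑[ x ∈ allFin n ] ∑[ a ∈ allVec (allFin n) (length σ) ]
    [ (lo ≤ᵇ toℕ x) ∧ compatibleFrom (toℕ x + g) σ (values a) ]* q ^ (toℕ x + sumL (values a))
    ≡⟨ sumOver-cong (allFin n) (λ x → sumOver-[∧]*-^ (allVec (allFin n) (length σ)) (lo ≤ᵇ toℕ x)
                                                     (compatibleFrom (toℕ x + g) σ ∘ values) q (toℕ x) (sumL ∘ values)) ⟩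
  ∑[ x ∈ allFin n ] [ lo ≤ᵇ toℕ x ]* q ^ toℕ x * compatibleSum n q σ (toℕ x + g)
    ≡⟨ sumOver-cong (allFin n) (λ x → cong (λ y → [ lo ≤ᵇ toℕ x ]* q ^ toℕ x * y)
                                           (compatibleSum-closedForm n q σ (toℕ x + g))) ⟩
  ∑[ x ∈ allFin n ] [ lo ≤ᵇ toℕ x ]* φ (toℕ x)
    ≡⟨ sumOver-≥-recurrence n φ closedForm vanishes recurrence lo ⟩
  closedForm lo
    ≡⟨ cong (λ D → q ^ (lo * suc (length σ) + ascentComaj (s ∷ σ)) * gaussian q (n ∸ lo + D) (suc (length σ)))
            (sym (des-∷ s σ)) ⟩
  q ^ (lo * suc (length σ) + ascentComaj (s ∷ σ)) * gaussian q (n ∸ lo + des (s ∷ σ)) (suc (length σ))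
    ∎
  where
  open ≡-Reasoning
  b = startsWithDescent s σ
  g = gapAfter s σ
  φ : ℕ → ℕ
  φ t = q ^ t * (q ^ ((t + g) * length σ + ascentComaj σ) * gaussian q (n ∸ (t + g) + des σ) (length σ))
  closedForm : ℕ → ℕ
  closedForm lo = q ^ (lo * suc (length σ) + ascentComaj (s ∷ σ))
                  * gaussian q (n ∸ lo + ((if b then 1 else 0) + des σ)) (suc (length σ))
  vanishes : ∀ lo → n ≤ lo → closedForm lo ≡ 0
  vanishes lo n≤lo = begin
    q ^ e * gaussian q (n ∸ lo + D) (suc (length σ))
      ≡⟨ cong (λ m → q ^ e * gaussian q (m + D) (suc (length σ))) (m≤n⇒m∸n≡0 n≤lo) ⟩
    q ^ e * gaussian q D (suc (length σ))
      ≡⟨ cong (q ^ e *_) (gaussian-< q (s≤s D≤length)) ⟩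
    q ^ e * 0
      ≡⟨ *-zeroʳ (q ^ e) ⟩
    0 ∎
    where
    e = lo * suc (length σ) + ascentComaj (s ∷ σ)
    D = (if b then 1 else 0) + des σ
    D≤length : D ≤ length σ
    D≤length = subst (_≤ length σ) (des-∷ s σ) (des-∷-≤ s σ)
  recurrence : ∀ lo → lo < n → closedForm lo ≡ φ lo + closedForm (suc lo)
  recurrence = closedForm-∷-recurrence q n b (length σ) (ascentComaj σ) (des σ)

shiftedCompatibleSum : ∀ n q σ {k} → length σ ≡ k →
  ∑[ a ∈ allVec (allFin n) k ] [ compatibleFrom 0 σ (values a) ]* q ^ (k + sumL (values a))
  ≡ q ^ (suc k C 2 ∸ comaj σ) * qbinom q (n + des σ) k
shiftedCompatibleSum n q σ refl = begin
  ∑[ a ∈ allVec (allFin n) (length σ) ] [ compatibleFrom 0 σ (values a) ]* q ^ (length σ + sumL (values a))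
    ≡⟨ sumOver-[∧]*-^ (allVec (allFin n) (length σ)) true (compatibleFrom 0 σ ∘ values) q (length σ)
                      (sumL ∘ values) ⟩
  q ^ length σ * compatibleSum n q σ 0
    ≡⟨ cong (q ^ length σ *_) (compatibleSum-closedForm n q σ 0) ⟩
  q ^ length σ * (q ^ ascentComaj σ * gaussian q (n + des σ) (length σ))
    ≡⟨ ^-*-merge q (length σ) (ascentComaj σ) _ ⟩
  q ^ (length σ + ascentComaj σ) * gaussian q (n + des σ) (length σ)
    ≡⟨ cong₂ (λ e x → q ^ e * x) exponent (sym (qbinom≡gaussian q (n + des σ) (length σ))) ⟩
  q ^ (suc (length σ) C 2 ∸ comaj σ) * qbinom q (n + des σ) (length σ)
    ∎
  where
  open ≡-Reasoning
  exponent : length σ + ascentComaj σ ≡ suc (length σ) C 2 ∸ comaj σ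
  exponent = sym (begin
    suc (length σ) C 2 ∸ comaj σ                         ≡⟨ cong (_∸ comaj σ) (suc-C-2 (length σ)) ⟩
    length σ + length σ C 2 ∸ comaj σ                    ≡⟨ cong (λ x → length σ + x ∸ comaj σ) (sym (ascentComaj+comaj σ)) ⟩
    length σ + (ascentComaj σ + comaj σ) ∸ comaj σ       ≡⟨ cong (_∸ comaj σ) (sym (+-assoc (length σ) _ _)) ⟩
    length σ + ascentComaj σ + comaj σ ∸ comaj σ         ≡⟨ m+n∸n≡m _ (comaj σ) ⟩
    length σ + ascentComaj σ                             ∎)

module InsertionSort {A : Set} {_<_ : Rel A 0ℓ} (_<?_ : Decidable _<_) where

  insert : ∀ {k} → A → Vec A k → Vec A (suc k)
  insert x Vec.[]      = x Vec.∷ Vec.[]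
  insert x (y Vec.∷ v) with x <? y
  ... | yes _ = x Vec.∷ y Vec.∷ v
  ... | no  _ = y Vec.∷ insert x v

  sort : ∀ {k} → Vec A k → Vec A k
  sort Vec.[]      = Vec.[]
  sort (x Vec.∷ v) = insert x (sort v)

  module _ {P : A → Set} where

    All-insert : ∀ {k x} {v : Vec A k} → P x → All P v → All P (insert x v)
    All-insert {v = Vec.[]}      px []         = px ∷ []
    All-insert {x = x} {y Vec.∷ v} px (py ∷ pv) with x <? y
    ... | yes _ = px ∷ py ∷ pv
    ... | no  _ = py ∷ All-insert px pv

    All-sort : ∀ {k} {v : Vec A k} → All P v → All P (sort v)
    All-sort []        = []
    All-sort (px ∷ pv) = All-insert px (All-sort pv)

    Any-insert : ∀ {k x} {v : Vec A k} → Any P (x Vec.∷ v) → Any P (insert x v)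
    Any-insert {v = Vec.[]}      p = p
    Any-insert {x = x} {y Vec.∷ v} p with x <? y
    ... | yes _ = p
    Any-insert {v = _ Vec.∷ v} (here px)          | no _ = there (Any-insert {v = v} (here px))
    Any-insert                 (there (here py))  | no _ = here py
    Any-insert {v = _ Vec.∷ v} (there (there pv)) | no _ = there (Any-insert {v = v} (there pv))

    Any-sort : ∀ {k} {v : Vec A k} → Any P v → Any P (sort v)
    Any-sort {v = x Vec.∷ v} (here px) = Any-insert {v = sort v} (here px)
    Any-sort {v = x Vec.∷ v} (there p) = Any-insert {v = sort v} (there (Any-sort p))

  module _ (<-trans : Transitive _<_) (<-connex : ∀ {x y} → x ≢ y → ¬ x < y → y < x) where

    insert-sorted : ∀ {k x} {v : Vec A k} → All (x ≢_) v → AllPairs _<_ v → AllPairs _<_ (insert x v)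
    insert-sorted {v = Vec.[]}      []            []                = [] ∷ []
    insert-sorted {x = x} {y Vec.∷ v} (x≢y ∷ x≢v) (y<v ∷ v-sorted) with x <? y
    ... | yes x<y = (x<y ∷ All.map (<-trans x<y) y<v) ∷ y<v ∷ v-sorted
    ... | no  x≮y = All-insert (<-connex x≢y x≮y) y<v ∷ insert-sorted x≢v v-sorted

    sort-sorted : ∀ {k} {v : Vec A k} → AllPairs _≢_ v → AllPairs _<_ (sort v)
    sort-sorted []              = []
    sort-sorted (x≢v ∷ v-distinct) = insert-sorted (All-sort x≢v) (sort-sorted v-distinct)

lookup-surjective⇒∈ : {A : Set} {k : ℕ} {w : Vec A k} → (∀ a → ∃[ i ] lookup w i ≡ a) → ∀ a → a ∈ w
lookup-surjective⇒∈ {w = w} onto a = let i , wi≡a = onto a in subst (_∈ w) wi≡a (∈-lookup i w)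

module SortedVectors {A : Set} {_<_ : Rel A 0ℓ} (<-irrefl : ∀ x → ¬ x < x) (<-trans : Transitive _<_) where

  AllPairs-lookup : ∀ {k} {w : Vec A k} → AllPairs _<_ w → ∀ {i j} → i Fin.< j → lookup w i < lookup w j
  AllPairs-lookup (x<w ∷ w-sorted) {fzero}  {fsuc j} _         = All.lookup⁺ x<w j
  AllPairs-lookup (x<w ∷ w-sorted) {fsuc i} {fsuc j} (s≤s i<j) = AllPairs-lookup w-sorted i<j

  AllPairs-lookup-injective : ∀ {k} {w : Vec A k} → AllPairs _<_ w → ∀ i j → lookup w i ≡ lookup w j → i ≡ j
  AllPairs-lookup-injective w-sorted i j wi≡wj with Fin.<-cmp i j
  ... | tri< i<j _ _ = ⊥-elim (<-irrefl _ (subst (_ <_) (sym wi≡wj) (AllPairs-lookup w-sorted i<j)))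
  ... | tri≈ _ i≡j _ = i≡j
  ... | tri> _ _ j<i = ⊥-elim (<-irrefl _ (subst (_ <_) wi≡wj (AllPairs-lookup w-sorted j<i)))

  AllPairs-unique : ∀ {k} {w w′ : Vec A k} → AllPairs _<_ w → AllPairs _<_ w′ →
                    (∀ {a} → a ∈ w → a ∈ w′) → (∀ {a} → a ∈ w′ → a ∈ w) → w ≡ w′
  AllPairs-unique {w = Vec.[]} {Vec.[]} _ _ _ _ = refl
  AllPairs-unique {w = x Vec.∷ v} {x′ Vec.∷ v′} (x<v ∷ v-sorted) (x′<v′ ∷ v′-sorted) w⊆w′ w′⊆w =
    cong₂ Vec._∷_ x≡x′
          (AllPairs-unique v-sorted v′-sorted (tail-⊆ x<v x≡x′ w⊆w′) (tail-⊆ x′<v′ (sym x≡x′) w′⊆w))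
    where
    x≡x′ : x ≡ x′
    x≡x′ with w⊆w′ (here refl) | w′⊆w (here refl)
    ... | here x≡x′  | _           = x≡x′
    ... | there _    | here x′≡x   = sym x′≡x
    ... | there x∈v′ | there x′∈v  = ⊥-elim (<-irrefl x (<-trans (All.lookup x<v x′∈v) (All.lookup x′<v′ x∈v′)))
    tail-⊆ : ∀ {k y y′} {u u′ : Vec A k} → All (y <_) u → y ≡ y′ →
             (∀ {a} → a ∈ y Vec.∷ u → a ∈ y′ Vec.∷ u′) → ∀ {a} → a ∈ u → a ∈ u′
    tail-⊆ y<u y≡y′ ⊆ a∈u with ⊆ (there a∈u)
    ... | here a≡y′  = ⊥-elim (<-irrefl _ (subst (_< _) (trans y≡y′ (sym a≡y′)) (All.lookup y<u a∈u)))
    ... | there a∈u′ = a∈u′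

T-andL⁻ : ∀ bs → T (andL bs) → ListAll.All T bs
T-andL⁻ []       _   = ListAll.[]
T-andL⁻ (b ∷ bs) tbs = let tb , tbs′ = Equivalence.to T-∧ tbs in tb ListAll.∷ T-andL⁻ bs tbs′

T-andL⁺ : ∀ {bs} → ListAll.All T bs → T (andL bs)
T-andL⁺ ListAll.[]         = tt
T-andL⁺ (tb ListAll.∷ tbs) = Equivalence.from T-∧ (tb , T-andL⁺ tbs)

T-andL-allFin² : ∀ {d} (P : Fin d → Fin d → Bool) →
                 T (andL (concatMap (λ v → map (P v) (allFin d)) (allFin d))) ⇔ (∀ v w → T (P v w))
T-andL-allFin² {d} P = mk⇔
  (λ t v → ListAll.tabulate⁻ (ListAll.map⁻
             (ListAll.tabulate⁻ (ListAll.map⁻ (ListAll.concat⁻ (T-andL⁻ _ t))) v)))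
  (λ t → T-andL⁺ (ListAll.concat⁺ (ListAll.map⁺
           (ListAll.tabulate⁺ λ v → ListAll.map⁺ (ListAll.tabulate⁺ (t v))))))

colour : ∀ {d n} → Vec (Fin n) d → Fin d → ℕ
colour c v = toℕ (lookup c v)

IsProper : ∀ {d n} → SimpleGraph d → Vec (Fin n) d → Set
IsProper G c = ∀ u v → adj G u v ≡ true → lookup c u ≢ lookup c v

module _ {d n} (G : SimpleGraph d) (c : Vec (Fin n) d) where

  properᵇ⇔IsProper : T (properᵇ G c) ⇔ IsProper G c
  properᵇ⇔IsProper = mk⇔ (λ t u v → edge⁻ u v (Equivalence.to (T-andL-allFin² _) t u v))
                         (λ p → Equivalence.from (T-andL-allFin² _) (λ u v → edge⁺ u v (p u v)))
    where
    edge⁻ : ∀ u v → T (not (adj G u v) ∨ not (does (lookup c u Fin.≟ lookup c v))) →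
            adj G u v ≡ true → lookup c u ≢ lookup c v
    edge⁻ u v t uv cu≡cv with adj G u v | lookup c u Fin.≟ lookup c v
    edge⁻ u v () refl cu≡cv | true | yes _
    edge⁻ u v t  refl cu≡cv | true | no cu≢cv = cu≢cv cu≡cv
    edge⁺ : ∀ u v → (adj G u v ≡ true → lookup c u ≢ lookup c v) →
            T (not (adj G u v) ∨ not (does (lookup c u Fin.≟ lookup c v)))
    edge⁺ u v p with adj G u v | lookup c u Fin.≟ lookup c v
    ... | false | _        = tt
    ... | true  | yes cu≡cv = p refl cu≡cv
    ... | true  | no  _     = tt

ArcsIncrease : ∀ {d n} → Orient d → Vec (Fin n) d → Set
ArcsIncrease o c = ∀ u v → arc o u v ≡ true → colour c u < colour c v

module _ {d n} {o : Orient d} {c : Vec (Fin n) d} (increase : ArcsIncrease o c) where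

  path-≤ : ∀ {u v} → Path o u v → colour c u ≤ colour c v
  path-≤ here         = ≤-refl
  path-≤ (step uv vw) = <⇒≤ (<-≤-trans (increase _ _ uv) (path-≤ vw))

  path-< : ∀ {u v} → Path o u v → u ≢ v → colour c u < colour c v
  path-< here         u≢u = ⊥-elim (u≢u refl)
  path-< (step uv vw) _   = <-≤-trans (increase _ _ uv) (path-≤ vw)

  ArcsIncrease⇒IsAcyclic : IsAcyclic o
  ArcsIncrease⇒IsAcyclic u v uv vu = <-irrefl refl (<-≤-trans (increase u v uv) (path-≤ vu))

orient-ext : ∀ {d} {o o′ : Orient d} → (∀ u v → arc o u v ≡ arc o′ u v) → o ≡ o′
orient-ext {o = o} {o′} same-arcs = begin
  o                    ≡⟨ sym (Vec.tabulate∘lookup o) ⟩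
  Vec.tabulate (lookup o)  ≡⟨ Vec.tabulate-cong row ⟩
  Vec.tabulate (lookup o′) ≡⟨ Vec.tabulate∘lookup o′ ⟩
  o′                   ∎
  where
  open ≡-Reasoning
  row : ∀ u → lookup o u ≡ lookup o′ u
  row u = trans (sym (Vec.tabulate∘lookup _)) (trans (Vec.tabulate-cong (same-arcs u)) (Vec.tabulate∘lookup _))

colourOrientation : ∀ {d n} → SimpleGraph d → Vec (Fin n) d → Orient d
colourOrientation G c = Vec.tabulate λ u → Vec.tabulate λ v → adj G u v ∧ (colour c u <ᵇ colour c v)

module _ {d n} (G : SimpleGraph d) (c : Vec (Fin n) d) where

  arc-colourOrientation : ∀ u v →
    arc (colourOrientation G c) u v ≡ true ⇔ (adj G u v ≡ true × colour c u < colour c v)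
  arc-colourOrientation u v = mk⇔ to from
    where
    arc≡ : arc (colourOrientation G c) u v ≡ (adj G u v ∧ (colour c u <ᵇ colour c v))
    arc≡ = trans (cong (λ row → lookup row v) (Vec.lookup∘tabulate _ u)) (Vec.lookup∘tabulate _ v)
    to : arc (colourOrientation G c) u v ≡ true → adj G u v ≡ true × colour c u < colour c v
    to u→v = let uv , cu<cv = Equivalence.to T-∧ (Equivalence.from T-≡ (trans (sym arc≡) u→v))
             in Equivalence.to T-≡ uv , <ᵇ⇒< _ _ cu<cv
    from : adj G u v ≡ true × colour c u < colour c v → arc (colourOrientation G c) u v ≡ true
    from (uv , cu<cv) = trans arc≡ (Equivalence.to T-≡ (Equivalence.from T-∧ (Equivalence.from T-≡ uv , <⇒<ᵇ cu<cv)))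

  colourOrientation-increase : ArcsIncrease (colourOrientation G c) c
  colourOrientation-increase u v = proj₂ ∘ Equivalence.to (arc-colourOrientation u v)

  colourOrientation-isAcyclicOrientation : IsProper G c → IsAcyclicOrientation G (colourOrientation G c)
  colourOrientation-isAcyclicOrientation proper =
    (along-edges , some-direction , antisymmetric) , ArcsIncrease⇒IsAcyclic {c = c} colourOrientation-increase
    where
    along-edges : ∀ u v → arc (colourOrientation G c) u v ≡ true → adj G u v ≡ true
    along-edges u v = proj₁ ∘ Equivalence.to (arc-colourOrientation u v)
    some-direction : ∀ u v → adj G u v ≡ true →
                     arc (colourOrientation G c) u v ≡ true ⊎ arc (colourOrientation G c) v u ≡ true
    some-direction u v uv with <-cmp (colour c u) (colour c v)
    ... | tri< cu<cv _ _ = inj₁ (Equivalence.from (arc-colourOrientation u v) (uv , cu<cv))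
    ... | tri≈ _ cu≡cv _ = ⊥-elim (proper u v uv (Fin.toℕ-injective cu≡cv))
    ... | tri> _ _ cv<cu = inj₂ (Equivalence.from (arc-colourOrientation v u) (trans (symm G v u) uv , cv<cu))
    antisymmetric : ∀ u v → arc (colourOrientation G c) u v ≡ true → arc (colourOrientation G c) v u ≡ false
    antisymmetric u v u→v with arc (colourOrientation G c) v u in v→u
    ... | false = refl
    ... | true  = ⊥-elim (<-asym (colourOrientation-increase u v u→v) (colourOrientation-increase v u v→u))

  module _ {o : Orient d} (o-orientation : IsOrientation G o) (increase : ArcsIncrease o c) where

    ArcsIncrease⇒IsProper : IsProper G c
    ArcsIncrease⇒IsProper u v uv cu≡cv with proj₁ (proj₂ o-orientation) u v uv
    ... | inj₁ u→v = <-irrefl (cong toℕ cu≡cv) (increase u v u→v)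
    ... | inj₂ v→u = <-irrefl (cong toℕ (sym cu≡cv)) (increase v u v→u)

    ArcsIncrease⇒≡colourOrientation : o ≡ colourOrientation G c
    ArcsIncrease⇒≡colourOrientation = orient-ext (λ u v → ⇔→≡ (mk⇔ (to u v) (from u v)))
      where
      to : ∀ u v → arc o u v ≡ true → arc (colourOrientation G c) u v ≡ true
      to u v u→v = Equivalence.from (arc-colourOrientation u v) (proj₁ o-orientation u v u→v , increase u v u→v)
      from : ∀ u v → arc (colourOrientation G c) u v ≡ true → arc o u v ≡ true
      from u v u→v with uv , cu<cv ← Equivalence.to (arc-colourOrientation u v) u→v
                  with proj₁ (proj₂ o-orientation) u v uv
      ... | inj₁ u→v = u→v
      ... | inj₂ v→u = ⊥-elim (<-asym cu<cv (increase v u v→u))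

Compatible : ∀ {d n} → (Fin d → Fin d) → Vec (Fin d) d → Vec (Fin n) d → Bool
Compatible {d} ω y c = compatibleFrom 0 (word ω y) (map (λ i → colour c (lookup y i)) (allFin d))

-- Listing the vertices in ⊏-order is the only way to make c compatible (compatible⇒sorted).
module ColourLabelOrder {d n} (c : Vec (Fin n) d) (ω : Fin d → Fin d) where

  _⊏_ : Rel (Fin d) 0ℓ
  u ⊏ v = colour c u < colour c v ⊎ (colour c u ≡ colour c v × ω v Fin.< ω u)

  _⊏?_ : Decidable _⊏_
  u ⊏? v = (colour c u <? colour c v) ⊎-dec ((colour c u ≟ colour c v) ×-dec (ω v Fin.<? ω u))

  ⊏-irrefl : ∀ u → ¬ u ⊏ u
  ⊏-irrefl u (inj₁ cu<cu)      = <-irrefl refl cu<cu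
  ⊏-irrefl u (inj₂ (_ , ωu<ωu)) = Fin.<-irrefl refl ωu<ωu

  ⊏-trans : Transitive _⊏_
  ⊏-trans (inj₁ cu<cv)          (inj₁ cv<cw)          = inj₁ (<-trans cu<cv cv<cw)
  ⊏-trans (inj₁ cu<cv)          (inj₂ (cv≡cw , _))    = inj₁ (subst (_ <_) cv≡cw cu<cv)
  ⊏-trans (inj₂ (cu≡cv , _))    (inj₁ cv<cw)          = inj₁ (subst (_< _) (sym cu≡cv) cv<cw)
  ⊏-trans (inj₂ (cu≡cv , ωv<ωu)) (inj₂ (cv≡cw , ωw<ωv)) = inj₂ (trans cu≡cv cv≡cw , Fin.<-trans ωw<ωv ωv<ωu)

  ⊏-connex : (∀ x y → ω x ≡ ω y → x ≡ y) → ∀ {u v} → u ≢ v → ¬ u ⊏ v → v ⊏ u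
  ⊏-connex ω-injective {u} {v} u≢v u⋢v with <-cmp (colour c u) (colour c v)
  ... | tri< cu<cv _ _ = ⊥-elim (u⋢v (inj₁ cu<cv))
  ... | tri> _ _ cv<cu = inj₁ cv<cu
  ... | tri≈ _ cu≡cv _ with Fin.<-cmp (ω u) (ω v)
  ...   | tri< ωu<ωv _ _ = inj₂ (sym cu≡cv , ωu<ωv)
  ...   | tri≈ _ ωu≡ωv _ = ⊥-elim (u≢v (ω-injective u v ωu≡ωv))
  ...   | tri> _ _ ωv<ωu = ⊥-elim (u⋢v (inj₂ (cu≡cv , ωv<ωu)))

  ⊏⇒colour-≤ : ∀ {u v} → u ⊏ v → colour c u ≤ colour c v
  ⊏⇒colour-≤ (inj₁ cu<cv)      = <⇒≤ cu<cv
  ⊏⇒colour-≤ (inj₂ (cu≡cv , _)) = ≤-reflexive cu≡cv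

  ⊏⇒colour-< : ∀ {u v} → u ⊏ v → ω u Fin.< ω v → colour c u < colour c v
  ⊏⇒colour-< (inj₁ cu<cv)      _     = cu<cv
  ⊏⇒colour-< (inj₂ (_ , ωv<ωu)) ωu<ωv = ⊥-elim (Fin.<-asym ωv<ωu ωu<ωv)

  open InsertionSort _⊏?_ public
  open SortedVectors ⊏-irrefl ⊏-trans public

  sortedVertices : Vec (Fin d) d
  sortedVertices = sort (Vec.allFin d)

  label : Fin d → ℕ
  label u = suc (toℕ (ω u))

  colour-step⇔⊏ : ∀ u v → colour c u + (if toℕ (ω v) <ᵇ toℕ (ω u) then 0 else 1) ≤ colour c v ⇔ u ⊏ v
  colour-step⇔⊏ u v with toℕ (ω v) <ᵇ toℕ (ω u) in ωv<ᵇωu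
  ... | true  = mk⇔ to from
    where
    ωv<ωu : ω v Fin.< ω u
    ωv<ωu = <ᵇ⇒< _ _ (subst T (sym ωv<ᵇωu) tt)
    to : colour c u + 0 ≤ colour c v → u ⊏ v
    to cu≤cv with m≤n⇒m<n∨m≡n (subst (_≤ colour c v) (+-identityʳ _) cu≤cv)
    ... | inj₁ cu<cv = inj₁ cu<cv
    ... | inj₂ cu≡cv = inj₂ (cu≡cv , ωv<ωu)
    from : u ⊏ v → colour c u + 0 ≤ colour c v
    from (inj₁ cu<cv)      = subst (_≤ colour c v) (sym (+-identityʳ _)) (<⇒≤ cu<cv)
    from (inj₂ (cu≡cv , _)) = subst (_≤ colour c v) (sym (+-identityʳ _)) (≤-reflexive cu≡cv)
  ... | false = mk⇔ to from
    where
    to : colour c u + 1 ≤ colour c v → u ⊏ v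
    to cu+1≤cv = inj₁ (subst (_≤ colour c v) (+-comm (colour c u) 1) cu+1≤cv)
    from : u ⊏ v → colour c u + 1 ≤ colour c v
    from (inj₁ cu<cv)           = subst (_≤ colour c v) (+-comm 1 (colour c u)) cu<cv
    from (inj₂ (_ , ωv<ωu)) = ⊥-elim (subst T ωv<ᵇωu (<⇒<ᵇ ωv<ωu))

  compatibleAlong : ℕ → ∀ {k} → Vec (Fin d) k → Bool
  compatibleAlong lo w = compatibleFrom lo (map label (toList w)) (map (colour c) (toList w))

  compatibleAlong⇒sorted : ∀ lo {k} (w : Vec (Fin d) k) → T (compatibleAlong lo w) → AllPairs _⊏_ w
  compatibleAlong⇒sorted lo Vec.[]                       _ = []
  compatibleAlong⇒sorted lo (u Vec.∷ Vec.[])             _ = [] ∷ []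
  compatibleAlong⇒sorted lo (u Vec.∷ w@(u′ Vec.∷ _)) t =
    let rest     = proj₂ (Equivalence.to (T-∧ {lo ≤ᵇ colour c u}) t)
        w-sorted = compatibleAlong⇒sorted (colour c u + gapAfter (label u) (map label (toList w))) w rest
        u⊏u′ = Equivalence.to (colour-step⇔⊏ u u′) (≤ᵇ⇒≤ _ _ (proj₁ (Equivalence.to T-∧ rest)))
    in (u⊏u′ ∷ All.map (⊏-trans u⊏u′) (AllPairs.head w-sorted)) ∷ w-sorted

  sorted⇒compatibleFrom : ∀ {lo k} u (w : Vec (Fin d) k) → AllPairs _⊏_ (u Vec.∷ w) → lo ≤ colour c u →
                          T (compatibleAlong lo (u Vec.∷ w))
  sorted⇒compatibleFrom u Vec.[]          _                   lo≤cu = Equivalence.from T-∧ (≤⇒≤ᵇ lo≤cu , tt)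
  sorted⇒compatibleFrom u (u′ Vec.∷ w) ((u⊏u′ ∷ _) ∷ u′-sorted) lo≤cu =
    Equivalence.from T-∧
      (≤⇒≤ᵇ lo≤cu , sorted⇒compatibleFrom u′ w u′-sorted (Equivalence.from (colour-step⇔⊏ u u′) u⊏u′))

  sorted⇒compatibleAlong : ∀ {k} (w : Vec (Fin d) k) → AllPairs _⊏_ w → T (compatibleAlong 0 w)
  sorted⇒compatibleAlong Vec.[]      _        = tt
  sorted⇒compatibleAlong (u Vec.∷ w) w-sorted = sorted⇒compatibleFrom u w w-sorted z≤n

  Compatible≡compatibleAlong : ∀ y → Compatible ω y c ≡ compatibleAlong 0 y
  Compatible≡compatibleAlong y = cong₂ (compatibleFrom 0) (map-allFin-lookup label y) (map-allFin-lookup (colour c) y)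

  compatible⇒sorted : ∀ {y} → T (Compatible ω y c) → AllPairs _⊏_ y
  compatible⇒sorted {y} = compatibleAlong⇒sorted 0 y ∘ subst T (Compatible≡compatibleAlong y)

  ∈-sortedVertices : ∀ u → u ∈ sortedVertices
  ∈-sortedVertices u = Any-sort (∈-allFin⁺ u)

  module _ (ω-injective : ∀ x y → ω x ≡ ω y → x ≡ y) where

    sortedVertices-sorted : AllPairs _⊏_ sortedVertices
    sortedVertices-sorted = sort-sorted ⊏-trans (⊏-connex ω-injective) (AllPairs.tabulate⁺ (λ i≢j → i≢j))

    sortedVertices-compatible : T (Compatible ω sortedVertices c)
    sortedVertices-compatible = subst T (sym (Compatible≡compatibleAlong sortedVertices))
                                        (sorted⇒compatibleAlong sortedVertices sortedVertices-sorted)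

    compatible⇒≡sortedVertices : ∀ {y} → (∀ u → ∃[ i ] lookup y i ≡ u) → T (Compatible ω y c) → y ≡ sortedVertices
    compatible⇒≡sortedVertices {y} y-onto y-compatible =
      AllPairs-unique (compatible⇒sorted {y} y-compatible) sortedVertices-sorted
                      (λ {u} _ → ∈-sortedVertices u) (λ {u} _ → lookup-surjective⇒∈ y-onto u)

    sortedVertices-isLinearExtension : ∀ {o} → ArcsIncrease o c → IsLinearExtension o sortedVertices
    sortedVertices-isLinearExtension {o} increase = (AllPairs-lookup-injective sortedVertices-sorted , onto) , order
      where
      onto : ∀ u → ∃[ i ] lookup sortedVertices i ≡ u
      onto u = Any.index (∈-sortedVertices u) , sym (lookup-index (∈-sortedVertices u))
      order : ∀ i j → lookup sortedVertices i ≺[ o ] lookup sortedVertices j → i Fin.< j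
      order i j (path , yi≢yj) with Fin.<-cmp i j
      ... | tri< i<j _ _ = i<j
      ... | tri≈ _ i≡j _ = ⊥-elim (yi≢yj (cong (lookup sortedVertices) i≡j))
      ... | tri> _ _ j<i = ⊥-elim (<⇒≱ (path-< {c = c} increase path yi≢yj)
                                        (⊏⇒colour-≤ (AllPairs-lookup sortedVertices-sorted j<i)))

module _ {d n} (G : SimpleGraph d) (c : Vec (Fin n) d) (ω : Fin d → Fin d) where

  open ColourLabelOrder c ω

  compatible⇒ArcsIncrease : ∀ {o y} → IsOrientation G o → IsNaturalLabeling o ω → IsLinearExtension o y →
                            T (Compatible ω y c) → ArcsIncrease o c
  compatible⇒ArcsIncrease {o} {y} o-orientation ω-natural y-linear y-compatible u v u→v =
    ⊏⇒colour-< u⊏v (ω-natural .proj₂ u v u≺v)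
    where
    u≢v : u ≢ v
    u≢v refl with () ← trans (sym (o-orientation .proj₁ u u u→v)) (irrefl G u)
    u≺v : u ≺[ o ] v
    u≺v = step u→v here , u≢v
    i = y-linear .proj₁ .proj₂ u .proj₁
    j = y-linear .proj₁ .proj₂ v .proj₁
    yi≡u = y-linear .proj₁ .proj₂ u .proj₂
    yj≡v = y-linear .proj₁ .proj₂ v .proj₂
    i<j : i Fin.< j
    i<j = y-linear .proj₂ i j (subst₂ (λ a b → a ≺[ o ] b) (sym yi≡u) (sym yj≡v) u≺v)
    u⊏v : u ⊏ v
    u⊏v = subst₂ _⊏_ yi≡u yj≡v (AllPairs-lookup (compatible⇒sorted {y} y-compatible) i<j)

weight : ∀ {d n} → ℕ → Vec (Fin n) d → ℕ
weight {d} q c = q ^ sumL (map (colorOf c) (allFin d))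

module AlongListing {d} (y : Vec (Fin d) d) (y-bijective : Bijective (lookup y)) where

  y⁻¹ : Fin d → Fin d
  y⁻¹ v = y-bijective .proj₂ v .proj₁

  lookup-y⁻¹ : ∀ v → lookup y (y⁻¹ v) ≡ v
  lookup-y⁻¹ v = y-bijective .proj₂ v .proj₂

  y⁻¹-lookup : ∀ i → y⁻¹ (lookup y i) ≡ i
  y⁻¹-lookup i = y-bijective .proj₁ _ _ (lookup-y⁻¹ (lookup y i))

  sumOver-vertices-along : (f : Fin d → ℕ) → sumOver (allFin d) f ≡ ∑[ i ∈ allFin d ] f (lookup y i)
  sumOver-vertices-along =
    sumOver-reindex (allFin d) (allFin d) (allFin-isEnumeration d) (allFin-isEnumeration d) Fin._≟_
                    y⁻¹ (lookup y) lookup-y⁻¹ y⁻¹-lookup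

  module _ {n : ℕ} where

    along : Vec (Fin n) d → Vec (Fin n) d
    along c = Vec.tabulate (λ i → lookup c (lookup y i))

    unalong : Vec (Fin n) d → Vec (Fin n) d
    unalong a = Vec.tabulate (λ v → lookup a (y⁻¹ v))

    lookup-unalong : ∀ a i → lookup (unalong a) (lookup y i) ≡ lookup a i
    lookup-unalong a i = trans (Vec.lookup∘tabulate _ (lookup y i)) (cong (lookup a) (y⁻¹-lookup i))

    sumOver-colourings-along : (F : Vec (Fin n) d → ℕ) →
                               sumOver (allVec (allFin n) d) F ≡ sumOver (allVec (allFin n) d) (F ∘ unalong)
    sumOver-colourings-along =
      sumOver-reindex colourings colourings colourings-enum colourings-enum (Vec.≡-dec Fin._≟_)
                      along unalong unalong-along along-unalong
      where
      colourings = allVec (allFin n) d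
      colourings-enum : IsEnumeration colourings
      colourings-enum = allVec-isEnumeration (allFin-isEnumeration n) d
      unalong-along : ∀ c → unalong (along c) ≡ c
      unalong-along c =
        trans (Vec.tabulate-cong (λ v → trans (Vec.lookup∘tabulate _ (y⁻¹ v)) (cong (lookup c) (lookup-y⁻¹ v))))
              (Vec.tabulate∘lookup c)
      along-unalong : ∀ a → along (unalong a) ≡ a
      along-unalong a = trans (Vec.tabulate-cong (lookup-unalong a)) (Vec.tabulate∘lookup a)

  compatibleColourings-sum : ∀ n q (ω : Fin d → Fin d) →
    ∑[ c ∈ allVec (allFin n) d ] [ Compatible ω y c ]* weight q c
    ≡ q ^ (suc d C 2 ∸ comaj (word ω y)) * qbinom q (n + des (word ω y)) d
  compatibleColourings-sum n q ω = begin
    ∑[ c ∈ allVec (allFin n) d ] [ Compatible ω y c ]* weight q c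
      ≡⟨ sumOver-colourings-along _ ⟩
    ∑[ a ∈ allVec (allFin n) d ] [ Compatible ω y (unalong a) ]* weight q (unalong a)
      ≡⟨ sumOver-cong (allVec (allFin n) d) (λ a →
           cong₂ (λ b e → [ b ]* q ^ e) (compatible-unalong a) (colours-unalong a)) ⟩
    ∑[ a ∈ allVec (allFin n) d ] [ compatibleFrom 0 (word ω y) (values a) ]* q ^ (d + sumL (values a))
      ≡⟨ shiftedCompatibleSum n q (word ω y) length-word ⟩
    q ^ (suc d C 2 ∸ comaj (word ω y)) * qbinom q (n + des (word ω y)) d
      ∎
    where
    open ≡-Reasoning
    length-word : length (word ω y) ≡ d
    length-word = trans (List.length-map _ (allFin d)) (List.length-tabulate (λ i → i))
    compatible-unalong : ∀ a → Compatible ω y (unalong a) ≡ compatibleFrom 0 (word ω y) (values a)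
    compatible-unalong a = cong (compatibleFrom 0 (word ω y))
      (trans (List.map-cong (λ i → cong toℕ (lookup-unalong a i)) (allFin d)) (map-allFin-lookup toℕ a))
    colours-unalong : ∀ a → sumL (map (colorOf (unalong a)) (allFin d)) ≡ d + sumL (values a)
    colours-unalong a = begin
      sumOver (allFin d) (colorOf (unalong a))
        ≡⟨ sumOver-vertices-along (colorOf (unalong a)) ⟩
      ∑[ i ∈ allFin d ] colorOf (unalong a) (lookup y i)
        ≡⟨ sumOver-cong (allFin d) (λ i → cong (suc ∘ toℕ) (lookup-unalong a i)) ⟩
      ∑[ i ∈ allFin d ] suc (toℕ (lookup a i))
        ≡⟨ sumOver-suc (allFin d) (λ i → toℕ (lookup a i)) ⟩
      length (allFin d) + (∑[ i ∈ allFin d ] toℕ (lookup a i))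
        ≡⟨ cong₂ _+_ (List.length-tabulate (λ i → i)) (cong sumL (map-allFin-lookup toℕ a)) ⟩
      d + sumL (values a)
        ∎

does⇒ : {P : Set} (P? : Dec P) → T (does P?) → P
does⇒ (yes p) _ = p

⇒does : {P : Set} (P? : Dec P) → P → T (does P?)
⇒does P? p = Equivalence.from T-≡ (dec-true P? p)

module _ {d} (G : SimpleGraph d)
         (decA : (o : Orient d) → Dec (IsAcyclicOrientation G o))
         (decL : (o : Orient d) (y : Vec (Fin d) d) → Dec (IsLinearExtension o y))
         (ω : Orient d → Fin d → Fin d)
         (ω-natural : (o : Orient d) → IsAcyclicOrientation G o → IsNaturalLabeling o (ω o)) where

  Admissible : ∀ {n} → Vec (Fin n) d → Orient d → Vec (Fin d) d → Bool
  Admissible c o y = does (decA o) ∧ (does (decL o y) ∧ Compatible (ω o) y c)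

  module _ {n} (c : Vec (Fin n) d) where

    open ColourLabelOrder c

    module Admissible⇒ (o : Orient d) (y : Vec (Fin d) d) (admissible : T (Admissible c o y)) where

      acyclic : IsAcyclicOrientation G o
      acyclic = does⇒ (decA o) (proj₁ (Equivalence.to (T-∧ {does (decA o)}) admissible))

      linear×compatible : T (does (decL o y)) × T (Compatible (ω o) y c)
      linear×compatible = Equivalence.to T-∧ (proj₂ (Equivalence.to (T-∧ {does (decA o)}) admissible))

      linear : IsLinearExtension o y
      linear = does⇒ (decL o y) (proj₁ linear×compatible)

      compatible : T (Compatible (ω o) y c)
      compatible = proj₂ linear×compatible

      increase : ArcsIncrease o c
      increase = compatible⇒ArcsIncrease G c (ω o) {o} {y} (acyclic .proj₁) (ω-natural o acyclic)
                                         linear compatible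

      proper : IsProper G c
      proper = ArcsIncrease⇒IsProper G c {o} (acyclic .proj₁) increase

    module _ (proper : IsProper G c) where

      o₀ : Orient d
      o₀ = colourOrientation G c

      y₀ : Vec (Fin d) d
      y₀ = sortedVertices (ω o₀)

      admissible₀ : T (Admissible c o₀ y₀)
      admissible₀ = Equivalence.from T-∧ (⇒does (decA o₀) acyclic₀ ,
                      Equivalence.from T-∧ (⇒does (decL o₀ y₀) linear₀ , compatible₀))
        where
        acyclic₀ = colourOrientation-isAcyclicOrientation G c proper
        ω₀-injective = ω-natural o₀ acyclic₀ .proj₁ .proj₁
        linear₀ = sortedVertices-isLinearExtension (ω o₀) ω₀-injective {o₀} (colourOrientation-increase G c)
        compatible₀ = sortedVertices-compatible (ω o₀) ω₀-injective

      admissible-unique : ∀ o y → T (Admissible c o y) → o ≡ o₀ × y ≡ y₀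
      admissible-unique o y admissible = o≡o₀ , trans y≡sorted (cong (sortedVertices ∘ ω) o≡o₀)
        where
        open Admissible⇒ o y admissible
        o≡o₀ = ArcsIncrease⇒≡colourOrientation G c {o} (acyclic .proj₁) increase
        y≡sorted = compatible⇒≡sortedVertices (ω o) (ω-natural o acyclic .proj₁ .proj₁) {y}
                                               (linear .proj₁ .proj₂) compatible

    sumOver-admissible : (w : ℕ) →
      ∑[ o ∈ allOrient d ] [ does (decA o) ]* ∑[ y ∈ allListings d ] [ does (decL o y) ]* [ Compatible (ω o) y c ]* w
      ≡ [ properᵇ G c ]* w
    sumOver-admissible w = begin
      ∑[ o ∈ allOrient d ] [ does (decA o) ]* ∑[ y ∈ allListings d ] [ does (decL o y) ]* [ Compatible (ω o) y c ]* w
        ≡⟨ sumOver-cong (allOrient d) (λ o → sumOver-[]* (allListings d) (does (decA o)) _) ⟩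
      ∑[ o ∈ allOrient d ] ∑[ y ∈ allListings d ] [ does (decA o) ]* [ does (decL o y) ]* [ Compatible (ω o) y c ]* w
        ≡⟨ sumOver-cong (allOrient d) (λ o → sumOver-cong (allListings d) (λ y →
             flatten (does (decA o)) (does (decL o y)) _)) ⟩
      ∑[ o ∈ allOrient d ] ∑[ y ∈ allListings d ] [ Admissible c o y ]* w
        ≡⟨ count (T? (properᵇ G c)) ⟩
      [ properᵇ G c ]* w
        ∎
      where
      open ≡-Reasoning
      flatten : ∀ a b b′ → [ a ]* [ b ]* [ b′ ]* w ≡ [ a ∧ (b ∧ b′) ]* w
      flatten a b b′ = trans (cong ([ a ]*_) ([]*-∧ b b′ w)) ([]*-∧ a (b ∧ b′) w)
      count : Dec (T (properᵇ G c)) →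
              ∑[ o ∈ allOrient d ] ∑[ y ∈ allListings d ] [ Admissible c o y ]* w ≡ [ properᵇ G c ]* w
      count (yes proper) = trans (sumOver²-unique (allOrient d) (allListings d)
                                    (allVec-isEnumeration (allVec-isEnumeration bools-isEnumeration d) d)
                                    (allVec-isEnumeration (allFin-isEnumeration d) d)
                                    (Admissible c) w (o₀ p) (y₀ p) (admissible₀ p) (admissible-unique p))
                                 (sym ([]*-true w proper))
        where
        p = Equivalence.to (properᵇ⇔IsProper G c) proper
      count (no improper) =
        trans (sumOver-zero (allOrient d) (λ o → sumOver-zero (allListings d) (λ y → []*-false w (inadmissible o y))))
              (sym ([]*-false w improper))
        where
        inadmissible : ∀ o y → ¬ T (Admissible c o y)
        inadmissible o y = improper ∘ Equivalence.from (properᵇ⇔IsProper G c) ∘ Admissible⇒.proper o y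

corollary10 :
    (d : ℕ) (G : SimpleGraph d)
    -- any decision procedures for the (paper-defined) predicates used to form the finite sets A(G) and L(Π_ρ)
    (decA : (o : Orient d) → Dec (IsAcyclicOrientation G o))
    (decL : (o : Orient d) (y : Vec (Fin d) d) → Dec (IsLinearExtension o y))
    -- a fixed natural labeling ω ρ of Π_ρ for each acyclic orientation ρ
    (ω : Orient d → Fin d → Fin d)
    (ωnat : (o : Orient d) → IsAcyclicOrientation G o → IsNaturalLabeling o (ω o))
    (n : ℕ) → 1 ≤ n → (q : ℕ) →
    chi1 G q n
      ≡ sumIf (allOrient d) (λ o → does (decA o))
          (λ o → sumIf (allListings d) (λ y → does (decL o y))
            (λ y → q ^ (((suc d) C 2) ∸ comaj (word (ω o) y))
                   * qbinom q (n + des (word (ω o) y)) d))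
-- The identity also holds for n = 0.
corollary10 d G decA decL ω ωnat n _ q = sym (begin
  ∑[ o ∈ Os ] [ A o ]* ∑[ y ∈ Ys ] [ L o y ]*
    q ^ (suc d C 2 ∸ comaj (word (ω o) y)) * qbinom q (n + des (word (ω o) y)) d
    ≡⟨ sumOver-cong Os (λ o → cong ([ A o ]*_) (sumOver-cong Ys (λ y → []*-cong (L o y) (λ l →
         sym (AlongListing.compatibleColourings-sum y (does⇒ (decL o y) l .proj₁) n q (ω o)))))) ⟩
  ∑[ o ∈ Os ] [ A o ]* ∑[ y ∈ Ys ] [ L o y ]* ∑[ c ∈ Cs ] [ Compatible (ω o) y c ]* weight q c
    ≡⟨ sumOver-cong Os (λ o → cong ([ A o ]*_) (sumOver-[]*-comm Ys Cs (L o) _)) ⟩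
  ∑[ o ∈ Os ] [ A o ]* ∑[ c ∈ Cs ] ∑[ y ∈ Ys ] [ L o y ]* [ Compatible (ω o) y c ]* weight q c
    ≡⟨ sumOver-[]*-comm Os Cs A _ ⟩
  ∑[ c ∈ Cs ] ∑[ o ∈ Os ] [ A o ]* ∑[ y ∈ Ys ] [ L o y ]* [ Compatible (ω o) y c ]* weight q c
    ≡⟨ sumOver-cong Cs (λ c → sumOver-admissible G decA decL ω ωnat c (weight q c)) ⟩
  ∑[ c ∈ Cs ] [ properᵇ G c ]* weight q c
    ∎)
  where
  open ≡-Reasoning
  Os = allOrient d
  Ys = allListings d
  Cs = allVec (allFin n) d
  A : Orient d → Bool
  A o = does (decA o)
  L : Orient d → Vec (Fin d) d → Bool
  L o y = does (decL o y)
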